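{- Let $G$ be a complete $s$-partite graph, and suppose exactly $r$ of its parts consist of a single vertex. Then $\chi_1(G)=s-r+\left\lceil \frac{r}{2}\right\rceil$.
   Context: A complete $s$-partite graph has its vertex set partitioned into $s$ nonempty parts, two vertices being adjacent iff they lie in different parts. A $1$-relaxed $k$-coloring is a map $f:V\to\{1,\dots,k\}$ such that every vertex $u$ has at most one neighbor $v$ with $f(v)=f(u)$; $\chi_1(G)$ is the minimum such $k$. -}

module Defs where

open import Data.Nat.Base using (ℕ; _≤_; _+_; _∸_; ⌈_/2⌉; NonZero)
open import Data.Nat.Properties using (_≟_)
open import Data.Fin.Base using (Fin)
open import Data.List.Base using (List; filter; length; allFin)
open import Data.Product using (Σ; _×_; ∃; proj₁)
open import Relation.Binary.PropositionalEquality using (_≡_; _≢_)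

record Graph : Set₁ where
  field
    V   : Set
    Adj : V → V → Set

open Graph public

Is1Relaxed : (G : Graph) (k : ℕ) → (V G → Fin k) → Set
Is1Relaxed G k f =
  ∀ (u v w : V G) → Adj G u v → f v ≡ f u → Adj G u w → f w ≡ f u → v ≡ w

Has1RelaxedColoring : Graph → ℕ → Set
Has1RelaxedColoring G k = Σ (V G → Fin k) (Is1Relaxed G k)

Chi1Is : Graph → ℕ → Set
Chi1Is G m = Has1RelaxedColoring G m × (∀ k → Has1RelaxedColoring G k → m ≤ k)

CompleteMultipartite : (s : ℕ) → (Fin s → ℕ) → Graph
CompleteMultipartite s n = record
  { V   = Σ (Fin s) (λ i → Fin (n i))
  ; Adj = λ u v → proj₁ u ≢ proj₁ v
  }

singletonParts : (s : ℕ) → (Fin s → ℕ) → ℕ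
singletonParts s n = length (filter (λ i → n i ≟ 1) (allFin s))

-- Colour every part with more than one vertex with its own colour and pair up the
-- singleton parts, giving s − r + ⌈r/2⌉ colours; in each colour class every vertex has
-- at most one neighbour. Conversely, in a 1-relaxed colouring three vertices of one
-- colour must lie in a common part (otherwise one of them has two neighbours of its
-- colour). Choosing two vertices from each non-singleton part and the vertex of each
-- singleton part gives 2(s − r) + r vertices with at most two of them per colour, so at
-- least s − r + ⌈r/2⌉ colours are needed.
module Submission where

open import Defs
open import Data.Nat.Base using (ℕ; _+_; _∸_; ⌈_/2⌉; _≤_)
open import Data.Fin.Base using (Fin)
open import Relation.Binary.PropositionalEquality using (_≡_)

open import Level using (Level; _⊔_)
open import Function.Base using (_∘_; id)
open import Function.Definitions using (Injective)
open import Data.Bool.Base using (Bool; true; false; not; if_then_else_)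
import Data.Bool.Properties as Bool
open import Data.Bool.Properties using (¬-not)
open import Data.Empty using (⊥-elim)
open import Data.Product using (Σ; ∃; _×_; _,_; proj₁; proj₂)
import Data.Product as Product
open import Data.Sum.Base using (inj₁; inj₂)
open import Data.List.Base using (filter; length; tabulate)
open import Data.Nat.Base using (zero; suc; _*_; _⊓_; ⌊_/2⌋; _<_; z≤n; s≤s)
open import Data.Nat.Properties
  using (_≟_; +-suc; +-identityʳ; +-cancelˡ-≡; +-monoʳ-<; <⇒≱; <-≤-trans; m≤m+n;
         ⌈n/2⌉-mono; 0≢1+n; suc-injective; m⊓n≤m; m⊓n≤n; ⊓-zeroʳ; m+n∸m≡n; module ≤-Reasoning)
open import Data.Fin.Base using (zero; suc; toℕ; fromℕ<; inject≤; splitAt; join; _↑ˡ_; _↑ʳ_; combine)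
import Data.Fin.Base as Fin
open import Data.Fin.Properties
  using (any?; <-cmp; <⇒≢; <-trans; combine-injective; fromℕ<-injective; inject≤-injective;
         toℕ-inject≤; toℕ-injective; injective⇒≤; join-splitAt)
import Data.Fin.Properties as Fin
open import Relation.Nullary using (Dec; yes; no; does)
open import Relation.Nullary.Decidable.Core using (_×-dec_)
open import Relation.Unary using (Pred; Decidable)
open import Relation.Binary.Definitions using (tri<; tri≈; tri>)
open import Relation.Binary.PropositionalEquality
  using (_≢_; refl; sym; trans; cong; ≢-sym; module ≡-Reasoning)

private
  variable
    a b ℓ : Level
    s k m : ℕ

indicator : Bool → ℕ
indicator true  = 1
indicator false = 0

count : (Fin s → Bool) → ℕ
count {zero}  p = 0
count {suc s} p = indicator (p zero) + count (p ∘ suc)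

rank : (Fin s → Bool) → Fin s → ℕ
rank p zero    = 0
rank p (suc i) = indicator (p zero) + rank (p ∘ suc) i

rank<count : (p : Fin s → Bool) {i : Fin s} → p i ≡ true → rank p i < count p
rank<count p {zero}  pᵢ rewrite pᵢ = s≤s z≤n
rank<count p {suc i} pᵢ = +-monoʳ-< (indicator (p zero)) (rank<count (p ∘ suc) pᵢ)

rank-injective : (p : Fin s → Bool) {i j : Fin s} → p i ≡ true → p j ≡ true →
                 rank p i ≡ rank p j → i ≡ j
rank-injective p {zero}  {zero}  _  _  _  = refl
rank-injective p {zero}  {suc j} p₀ _  eq =
  ⊥-elim (0≢1+n (trans eq (cong (λ x → indicator x + rank (p ∘ suc) j) p₀)))
rank-injective p {suc i} {zero}  _  p₀ eq =
  ⊥-elim (0≢1+n (trans (sym eq) (cong (λ x → indicator x + rank (p ∘ suc) i) p₀)))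
rank-injective p {suc i} {suc j} pᵢ pⱼ eq =
  cong suc (rank-injective (p ∘ suc) pᵢ pⱼ (+-cancelˡ-≡ (indicator (p zero)) _ _ eq))

count+count-not : (p : Fin s → Bool) → count p + count (not ∘ p) ≡ s
count+count-not {zero}  p = refl
count+count-not {suc s} p with p zero
... | true  = cong suc (count+count-not (p ∘ suc))
... | false = trans (+-suc (count (p ∘ suc)) _) (cong suc (count+count-not (p ∘ suc)))

length-filter-tabulate : {A : Set a} {P : Pred A ℓ} (P? : Decidable P) (g : Fin s → A) →
                         length (filter P? (tabulate g)) ≡ count (λ i → does (P? (g i)))
length-filter-tabulate {s = zero}  P? g = refl
length-filter-tabulate {s = suc s} P? g with does (P? (g zero))
... | true  = cong suc (length-filter-tabulate P? (g ∘ suc))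
... | false = length-filter-tabulate P? (g ∘ suc)

AtMostTwoToOne : {A : Set a} {B : Set b} → (A → B) → Set (a ⊔ b)
AtMostTwoToOne f = ∀ x y z → x ≢ y → f y ≡ f x → x ≢ z → f z ≡ f x → y ≡ z

atMostTwoToOne-∘-injective : {A : Set a} {B : Set b} {C : Set ℓ} {f : B → C} {g : A → B} →
                             AtMostTwoToOne f → Injective _≡_ _≡_ g → AtMostTwoToOne (f ∘ g)
atMostTwoToOne-∘-injective f-2:1 g-inj x y z x≢y eᵧ x≢z e_z =
  g-inj (f-2:1 _ _ _ (x≢y ∘ g-inj) eᵧ (x≢z ∘ g-inj) e_z)

-- Tagging each point by whether an earlier point has the same image turns f into an
-- injection into Fin k × Fin 2.
atMostTwoToOne⇒≤*2 : {f : Fin m → Fin k} → AtMostTwoToOne f → m ≤ k * 2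
atMostTwoToOne⇒≤*2 {m} {k} {f} f-2:1 = injective⇒≤ {f = tagged} tagged-injective
  where
  HasEarlierTwin : Fin m → Set
  HasEarlierTwin x = ∃ λ y → y Fin.< x × f y ≡ f x

  hasEarlierTwin? : ∀ x → Dec (HasEarlierTwin x)
  hasEarlierTwin? x = any? (λ y → (y Fin.<? x) ×-dec (f y Fin.≟ f x))

  bit : ∀ {x} → Dec (HasEarlierTwin x) → Fin 2
  bit (yes _) = suc zero
  bit (no _)  = zero

  tagged : Fin m → Fin (k * 2)
  tagged x = combine (f x) (bit (hasEarlierTwin? x))

  twins-differ-in-bit : ∀ {x y} → x Fin.< y → f x ≡ f y →
                        bit (hasEarlierTwin? x) ≢ bit (hasEarlierTwin? y)
  twins-differ-in-bit {x} {y} x<y fx≡fy with hasEarlierTwin? x | hasEarlierTwin? y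
  ... | _    | no ¬twin = λ _ → ¬twin (x , x<y , fx≡fy)
  ... | no _ | yes _    = λ ()
  ... | yes (z , z<x , fz≡fx) | yes _ = λ _ →
    <⇒≢ (<-trans z<x x<y) (f-2:1 x z y (≢-sym (<⇒≢ z<x)) fz≡fx (<⇒≢ x<y) (sym fx≡fy))

  tagged-injective : Injective _≡_ _≡_ tagged
  tagged-injective {x} {y} eq with combine-injective (f x) _ (f y) _ eq | <-cmp x y
  ... | _             , _      | tri≈ _ x≡y _ = x≡y
  ... | fx≡fy         , bx≡by  | tri< x<y _ _ = ⊥-elim (twins-differ-in-bit x<y fx≡fy bx≡by)
  ... | fx≡fy         , bx≡by  | tri> _ _ y<x =
    ⊥-elim (twins-differ-in-bit y<x (sym fx≡fy) (sym bx≡by))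

Fin2-atMostTwo : (x y z : Fin 2) → x ≢ y → x ≢ z → y ≡ z
Fin2-atMostTwo zero       (suc zero) (suc zero) _   _   = refl
Fin2-atMostTwo (suc zero) zero       zero       _   _   = refl
Fin2-atMostTwo zero       zero       _          x≢y _   = ⊥-elim (x≢y refl)
Fin2-atMostTwo (suc zero) (suc zero) _          x≢y _   = ⊥-elim (x≢y refl)
Fin2-atMostTwo zero       (suc zero) zero       _   x≢z = ⊥-elim (x≢z refl)
Fin2-atMostTwo (suc zero) zero       (suc zero) _   x≢z = ⊥-elim (x≢z refl)

Fin[⊓2]-atMostTwo : (x y z : Fin (m ⊓ 2)) → x ≢ y → x ≢ z → y ≡ z
Fin[⊓2]-atMostTwo {m} x y z x≢y x≢z =
  inject≤-injective _ _ y z (Fin2-atMostTwo (ι x) (ι y) (ι z) (x≢y ∘ ι-injective) (x≢z ∘ ι-injective))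
  where
  ι : Fin (m ⊓ 2) → Fin 2
  ι w = inject≤ w (m⊓n≤n m 2)

  ι-injective : Injective _≡_ _≡_ ι
  ι-injective = inject≤-injective _ _ _ _

-- The other element of the ⌊_/2⌋-fibre of n, i.e. n xor 1.
partner : ℕ → ℕ
partner zero          = 1
partner (suc zero)    = 0
partner (suc (suc n)) = 2 + partner n

⌊/2⌋-fibre : ∀ m n → m ≢ n → ⌊ n /2⌋ ≡ ⌊ m /2⌋ → n ≡ partner m
⌊/2⌋-fibre zero          zero          m≢n _  = ⊥-elim (m≢n refl)
⌊/2⌋-fibre zero          (suc zero)    _   _  = refl
⌊/2⌋-fibre (suc zero)    zero          _   _  = refl
⌊/2⌋-fibre (suc zero)    (suc zero)    m≢n _  = ⊥-elim (m≢n refl)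
⌊/2⌋-fibre (suc (suc m)) (suc (suc n)) m≢n eq =
  cong (2 +_) (⌊/2⌋-fibre m n (m≢n ∘ cong (2 +_)) (suc-injective eq))

⌊/2⌋-atMostTwoToOne : AtMostTwoToOne ⌊_/2⌋
⌊/2⌋-atMostTwoToOne x y z x≢y eᵧ x≢z e_z =
  trans (⌊/2⌋-fibre x y x≢y eᵧ) (sym (⌊/2⌋-fibre x z x≢z e_z))

⌈*2+/2⌉ : ∀ q r → ⌈ q * 2 + r /2⌉ ≡ q + ⌈ r /2⌉
⌈*2+/2⌉ zero    r = refl
⌈*2+/2⌉ (suc q) r = cong suc (⌈*2+/2⌉ q r)

*2+≤*2⇒+⌈/2⌉≤ : ∀ q r k → q * 2 + r ≤ k * 2 → q + ⌈ r /2⌉ ≤ k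
*2+≤*2⇒+⌈/2⌉≤ q r k le = begin
  q + ⌈ r /2⌉        ≡⟨ ⌈*2+/2⌉ q r ⟨
  ⌈ q * 2 + r /2⌉    ≤⟨ ⌈n/2⌉-mono le ⟩
  ⌈ k * 2 /2⌉        ≡⟨ cong ⌈_/2⌉ (+-identityʳ (k * 2)) ⟨
  ⌈ k * 2 + 0 /2⌉    ≡⟨ ⌈*2+/2⌉ k 0 ⟩
  k + 0              ≡⟨ +-identityʳ k ⟩
  k                  ∎
  where open ≤-Reasoning

∑ : (Fin s → ℕ) → ℕ
∑ {zero}  m = 0
∑ {suc s} m = m zero + ∑ (m ∘ suc)

flatten : (m : Fin s → ℕ) → Σ (Fin s) (Fin ∘ m) → Fin (∑ m)
flatten m (zero  , x) = x ↑ˡ ∑ (m ∘ suc)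
flatten m (suc i , x) = m zero ↑ʳ flatten (m ∘ suc) (i , x)

unflatten : (m : Fin s → ℕ) → Fin (∑ m) → Σ (Fin s) (Fin ∘ m)
unflatten {suc s} m x with splitAt (m zero) x
... | inj₁ y = zero , y
... | inj₂ y = Product.map suc id (unflatten (m ∘ suc) y)

flatten∘unflatten : (m : Fin s → ℕ) (x : Fin (∑ m)) → flatten m (unflatten m x) ≡ x
flatten∘unflatten {suc s} m x with splitAt (m zero) x in eq
... | inj₁ y = trans (cong (join _ _) (sym eq)) (join-splitAt (m zero) _ x)
... | inj₂ y = begin
  m zero ↑ʳ flatten (m ∘ suc) (unflatten (m ∘ suc) y) ≡⟨ cong (m zero ↑ʳ_) (flatten∘unflatten (m ∘ suc) y) ⟩
  join (m zero) _ (inj₂ y)                             ≡⟨ cong (join _ _) eq ⟨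
  join (m zero) _ (splitAt (m zero) x)                 ≡⟨ join-splitAt (m zero) _ x ⟩
  x                                                    ∎
  where open ≡-Reasoning

unflatten-injective : (m : Fin s → ℕ) → Injective _≡_ _≡_ (unflatten m)
unflatten-injective m {x} {y} eq = begin
  x                          ≡⟨ flatten∘unflatten m x ⟨
  flatten m (unflatten m x)  ≡⟨ cong (flatten m) eq ⟩
  flatten m (unflatten m y)  ≡⟨ flatten∘unflatten m y ⟩
  y                          ∎
  where open ≡-Reasoning

isSingletonPart : (Fin s → ℕ) → Fin s → Bool
isSingletonPart n i = does (n i ≟ 1)

isSingletonPart⇒≡1 : (n : Fin s → ℕ) {i : Fin s} → isSingletonPart n i ≡ true → n i ≡ 1
isSingletonPart⇒≡1 n {i} eq with n i
... | suc zero = refl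

singletons nonSingletons : (Fin s → ℕ) → ℕ
singletons    n = count (isSingletonPart n)
nonSingletons n = count (not ∘ isSingletonPart n)

singletonParts≡singletons : (n : Fin s → ℕ) → singletonParts s n ≡ singletons n
singletonParts≡singletons n = length-filter-tabulate (λ i → n i ≟ 1) id

nonSingletons≡∸singletons : (n : Fin s → ℕ) → nonSingletons n ≡ s ∸ singletons n
nonSingletons≡∸singletons {s} n = begin
  nonSingletons n                                    ≡⟨ m+n∸m≡n (singletons n) _ ⟨
  singletons n + nonSingletons n ∸ singletons n      ≡⟨ cong (_∸ singletons n) (count+count-not _) ⟩
  s ∸ singletons n                                   ∎
  where open ≡-Reasoning

∑[⊓2]≡ : (n : Fin s → ℕ) → (∀ i → 1 ≤ n i) →
         ∑ (λ i → n i ⊓ 2) ≡ nonSingletons n * 2 + singletons n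
∑[⊓2]≡ {zero}  n _       = refl
∑[⊓2]≡ {suc s} n parts≥1 with n zero | parts≥1 zero | ∑[⊓2]≡ (n ∘ suc) (parts≥1 ∘ suc)
... | suc zero    | _ | ih = trans (cong suc ih) (sym (+-suc _ _))
... | suc (suc m) | _ | ih rewrite ⊓-zeroʳ m = cong (2 +_) ih

Fin1-unique : m ≡ 1 → (x y : Fin m) → x ≡ y
Fin1-unique refl zero zero = refl

partColouring-isRelaxed : (n : Fin s → ℕ) (c : Fin s → ℕ) (c<k : ∀ i → c i < k) →
                          AtMostTwoToOne c → (∀ {i j} → i ≢ j → c j ≡ c i → n j ≡ 1) →
                          Is1Relaxed (CompleteMultipartite s n) k (λ u → fromℕ< (c<k (proj₁ u)))
partColouring-isRelaxed n c c<k c-2:1 shared⇒singleton (i , _) (j , x) (l , y) i≢j eⱼ i≢l eₗ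
  with refl ← c-2:1 i j l i≢j (fromℕ<-injective _ _ _ _ eⱼ) i≢l (fromℕ<-injective _ _ _ _ eₗ)
  = cong (j ,_) (Fin1-unique (shared⇒singleton i≢j (fromℕ<-injective _ _ _ _ eⱼ)) x y)

module _ {s : ℕ} (n : Fin s → ℕ) where
  private
    p q : Fin s → Bool
    p = isSingletonPart n
    q = not ∘ p

  partColour : Fin s → ℕ
  partColour i = if p i then nonSingletons n + ⌊ rank p i /2⌋ else rank q i

  partColour-singleton : ∀ {i} → p i ≡ true → partColour i ≡ nonSingletons n + ⌊ rank p i /2⌋
  partColour-singleton pᵢ rewrite pᵢ = refl

  partColour-nonSingleton : ∀ {i} → p i ≡ false → partColour i ≡ rank q i
  partColour-nonSingleton pᵢ rewrite pᵢ = refl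

  partColour<χ₁ : ∀ i → partColour i < nonSingletons n + ⌈ singletons n /2⌉
  partColour<χ₁ i with p i in pᵢ
  ... | true  = +-monoʳ-< (nonSingletons n) (⌈n/2⌉-mono (rank<count p pᵢ))
  ... | false = <-≤-trans (rank<count q (cong not pᵢ)) (m≤m+n _ _)

  partColour-shared⇒singleton : ∀ {i j} → i ≢ j → partColour j ≡ partColour i → p j ≡ true
  partColour-shared⇒singleton {i} {j} i≢j eq with p j Bool.≟ true | p i Bool.≟ true
  ... | yes pⱼ | _      = pⱼ
  ... | no pⱼ  | no pᵢ  = ⊥-elim (i≢j (rank-injective q (cong not (¬-not pᵢ)) (cong not (¬-not pⱼ)) (begin
    rank q i      ≡⟨ partColour-nonSingleton (¬-not pᵢ) ⟨
    partColour i  ≡⟨ eq ⟨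
    partColour j  ≡⟨ partColour-nonSingleton (¬-not pⱼ) ⟩
    rank q j      ∎)))
    where open ≡-Reasoning
  ... | no pⱼ  | yes pᵢ = ⊥-elim (<⇒≱ (rank<count q (cong not (¬-not pⱼ))) (begin
    nonSingletons n                    ≤⟨ m≤m+n _ _ ⟩
    nonSingletons n + ⌊ rank p i /2⌋   ≡⟨ partColour-singleton pᵢ ⟨
    partColour i                       ≡⟨ eq ⟨
    partColour j                       ≡⟨ partColour-nonSingleton (¬-not pⱼ) ⟩
    rank q j                           ∎))
    where open ≤-Reasoning

  partColour-atMostTwoToOne : AtMostTwoToOne partColour
  partColour-atMostTwoToOne i j l i≢j eⱼ i≢l eₗ =
    rank-injective p pⱼ pₗ
      (⌊/2⌋-atMostTwoToOne (rank p i) (rank p j) (rank p l)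
        (rank≢ i≢j pⱼ) (half pⱼ eⱼ) (rank≢ i≢l pₗ) (half pₗ eₗ))
    where
    open ≡-Reasoning
    pᵢ : p i ≡ true
    pᵢ = partColour-shared⇒singleton (≢-sym i≢j) (sym eⱼ)
    pⱼ : p j ≡ true
    pⱼ = partColour-shared⇒singleton i≢j eⱼ
    pₗ : p l ≡ true
    pₗ = partColour-shared⇒singleton i≢l eₗ

    rank≢ : ∀ {j} → i ≢ j → p j ≡ true → rank p i ≢ rank p j
    rank≢ i≢j pⱼ = i≢j ∘ rank-injective p pᵢ pⱼ

    half : ∀ {j} → p j ≡ true → partColour j ≡ partColour i → ⌊ rank p j /2⌋ ≡ ⌊ rank p i /2⌋
    half {j} pⱼ e = +-cancelˡ-≡ (nonSingletons n) _ _ (begin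
      nonSingletons n + ⌊ rank p j /2⌋  ≡⟨ partColour-singleton pⱼ ⟨
      partColour j                      ≡⟨ e ⟩
      partColour i                      ≡⟨ partColour-singleton pᵢ ⟩
      nonSingletons n + ⌊ rank p i /2⌋  ∎)

  χ₁≤ : Has1RelaxedColoring (CompleteMultipartite s n) (nonSingletons n + ⌈ singletons n /2⌉)
  χ₁≤ = _ , partColouring-isRelaxed n partColour partColour<χ₁ partColour-atMostTwoToOne
              (λ i≢j e → isSingletonPart⇒≡1 n (partColour-shared⇒singleton i≢j e))

  sampleVertex : Σ (Fin s) (λ i → Fin (n i ⊓ 2)) → V (CompleteMultipartite s n)
  sampleVertex (i , x) = i , inject≤ x (m⊓n≤m (n i) 2)

  sampleVertex-injective : Injective _≡_ _≡_ sampleVertex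
  sampleVertex-injective {i , x} {j , y} eq with refl ← cong proj₁ eq =
    cong (i ,_) (toℕ-injective (begin
      toℕ x                          ≡⟨ toℕ-inject≤ x _ ⟨
      toℕ (inject≤ x _)              ≡⟨ cong (toℕ ∘ proj₂) eq ⟩
      toℕ (inject≤ y _)              ≡⟨ toℕ-inject≤ y _ ⟩
      toℕ y                          ∎))
    where open ≡-Reasoning

  relaxed⇒sample-atMostTwoToOne : {f : V (CompleteMultipartite s n) → Fin k} →
                                  Is1Relaxed (CompleteMultipartite s n) k f →
                                  AtMostTwoToOne (f ∘ sampleVertex)
  relaxed⇒sample-atMostTwoToOne f-rel u@(i , _) v@(j , y) w@(l , z) u≢v eᵥ u≢w e_w
    with i Fin.≟ j | i Fin.≟ l
  ... | no i≢j   | no i≢l   = sampleVertex-injective (f-rel _ _ _ i≢j eᵥ i≢l e_w)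
  ... | yes refl | no i≢l   = ⊥-elim (u≢v (sampleVertex-injective
    (f-rel (sampleVertex w) _ _ (≢-sym i≢l) (sym e_w) (≢-sym i≢l) (trans eᵥ (sym e_w)))))
  ... | no i≢j   | yes refl = ⊥-elim (u≢w (sampleVertex-injective
    (f-rel (sampleVertex v) _ _ (≢-sym i≢j) (sym eᵥ) (≢-sym i≢j) (trans e_w (sym eᵥ)))))
  ... | yes refl | yes refl =
    cong (i ,_) (Fin[⊓2]-atMostTwo (proj₂ u) y z (u≢v ∘ cong (i ,_)) (u≢w ∘ cong (i ,_)))

  χ₁≥ : (∀ i → 1 ≤ n i) → Has1RelaxedColoring (CompleteMultipartite s n) k →
        nonSingletons n + ⌈ singletons n /2⌉ ≤ k
  χ₁≥ {k} parts≥1 (f , f-rel) = *2+≤*2⇒+⌈/2⌉≤ (nonSingletons n) (singletons n) k (begin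
    nonSingletons n * 2 + singletons n  ≡⟨ ∑[⊓2]≡ n parts≥1 ⟨
    ∑ (λ i → n i ⊓ 2)                   ≤⟨ atMostTwoToOne⇒≤*2 (atMostTwoToOne-∘-injective
                                             (relaxed⇒sample-atMostTwoToOne f-rel)
                                             (unflatten-injective (λ i → n i ⊓ 2))) ⟩
    k * 2                               ∎)
    where open ≤-Reasoning

theorem4p3 : (s : ℕ) (n : Fin s → ℕ) → (∀ i → 1 ≤ n i) → (r : ℕ) →
    singletonParts s n ≡ r →
    Chi1Is (CompleteMultipartite s n) (s ∸ r + ⌈ r /2⌉)
theorem4p3 s n parts≥1 _ refl
  rewrite singletonParts≡singletons n | sym (nonSingletons≡∸singletons n)
  = χ₁≤ n , λ _ → χ₁≥ n parts≥1
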